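{- Let $r\ge 2$ and $n$ be integers and $\alpha$ a real number. There exists an $r$-graph $H$ on $n+1$ vertices with minimum vertex degree $\delta_1(H)\ge\alpha\binom{n-1}{r-1}$ and no $K_{r+1}^{(r)}$-covering if and only if there exists an $(r-1)$-graph $G$ on $n$ vertices with at least $\alpha\binom{n-1}{r-1}$ edges such that for every vertex $x\in V(G)$, $t_G(x)-\deg_G(x)\le(1-\alpha)\binom{n-1}{r-1}$.
   Context: An $r$-graph is an $r$-uniform hypergraph; $K_t^{(r)}$ is the complete $r$-graph on $t$ vertices. For a hypergraph $G$ and vertex $x$, $\deg_G(x)$ is the number of edges containing $x$, and $\delta_1(G)$ is the minimum of $\deg_G(x)$ over all vertices. For an $(r-1)$-graph $G$, $t_G(x)$ is the number of copies of $K_r^{(r-1)}$ in $G$ containing $x$. An $r$-graph $H$ has a $K_{r+1}^{(r)}$-covering if every vertex of $H$ lies in a copy of $K_{r+1}^{(r)}$ in $H$.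
   Formalization: The parameter α ranges over the rationals instead of the reals. -}

module Defs where

open import Data.Nat using (ℕ; zero; suc; _≡ᵇ_)
open import Data.Bool using (Bool; true; false; _∧_; _∨_; not; T)
open import Data.List using (List; []; _∷_; map; _++_; filter; length; foldr)
open import Relation.Nullary.Decidable using (T?)
open import Data.Vec using (_∷_; [])
open import Data.Fin using (Fin)
open import Data.Fin.Subset using (Subset; inside; outside; _∈_; ∣_∣)
open import Data.Fin.Subset.Properties using (_∈?_; _⊆?_)
open import Data.Product using (Σ; _×_)
open import Relation.Nullary using (does)
open import Relation.Binary.PropositionalEquality using (_≡_)
open import Data.Integer using (+_)
open import Data.Rational using (ℚ; _/_)

allSubsets : (N : ℕ) → List (Subset N)
allSubsets zero = [] ∷ []
allSubsets (suc N) = map (outside ∷_) (allSubsets N) ++ map (inside ∷_) (allSubsets N)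

count : {A : Set} → (A → Bool) → List A → ℕ
count p xs = length (filter (λ a → T? (p a)) xs)

allB : {A : Set} → (A → Bool) → List A → Bool
allB p = foldr (λ a b → p a ∧ b) true

record Graph (r N : ℕ) : Set where
  field
    edge    : Subset N → Bool
    uniform : (e : Subset N) → T (edge e) → ∣ e ∣ ≡ r
open Graph public

numEdges : {r N : ℕ} → Graph r N → ℕ
numEdges {r} {N} G = count (edge G) (allSubsets N)

deg : {r N : ℕ} → Graph r N → Fin N → ℕ
deg {r} {N} G x = count (λ e → edge G e ∧ does (x ∈? e)) (allSubsets N)

isCliqueB : {r N : ℕ} → Graph r N → Subset N → Bool
isCliqueB {r} {N} G S =
  (∣ S ∣ ≡ᵇ suc r) ∧
  allB (λ e → not (does (e ⊆? S) ∧ (∣ e ∣ ≡ᵇ r)) ∨ edge G e) (allSubsets N)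

-- t_G(x): number of copies of K_{r+1}^{(r)} in the r-graph G containing x.
-- (Applied to an (r-1)-graph this is the paper's t_G(x), counting K_r^{(r-1)}.)
tCount : {r N : ℕ} → Graph r N → Fin N → ℕ
tCount {r} {N} G x = count (λ S → isCliqueB G S ∧ does (x ∈? S)) (allSubsets N)

HasCovering : {r N : ℕ} → Graph r N → Set
HasCovering {r} {N} H = (x : Fin N) → Σ (Subset N) (λ S → x ∈ S × T (isCliqueB H S))

ℕtoℚ : ℕ → ℚ
ℕtoℚ n = + n / 1

{-# OPTIONS --safe #-}
-- Take a vertex v of H in no copy of K_{r+1}^{(r)} and let G be its link, so e(G) = deg_H(v).
-- An edge of H avoiding v cannot span a K_r^{(r-1)} of G, since together with v it would span a
-- K_{r+1}^{(r)}. The r-sets through x split into the t_G(x) cliques of G and the rest, so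
-- deg_H(x) ≤ deg_G(x) + C(n-1, r-1) - t_G(x), and the degree bound becomes the bound on t_G(x) - deg_G(x).
-- Conversely, the cone over G whose edges avoiding the apex are exactly the r-sets spanning no
-- K_r^{(r-1)} of G attains this with equality, and its apex lies in no K_{r+1}^{(r)}.
module Submission where

open import Defs
open import Data.Nat using (ℕ; suc; _∸_; _≤_)
open import Data.Nat.Combinatorics using (_C_)
open import Data.Fin using (Fin)
open import Data.Product using (Σ; _×_)
open import Relation.Nullary using (¬_)
open import Function.Bundles using (_⇔_)
open import Data.Rational using (ℚ; 1ℚ; _*_; _-_) renaming (_≤_ to _≤ℚ_)

open import Data.Bool using (Bool; true; false; _∧_; _∨_; not; T)
open import Data.Bool.Properties using (T-∧; ∧-zeroʳ; ∧-identityʳ)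
import Data.Fin as Fin
open import Data.Fin using (punchIn) renaming (zero to fzero; suc to fsuc)
open import Data.Fin.Properties using (¬∀⟶∃¬; punchIn-punchOut)
open import Data.Fin.Subset using (Subset; inside; outside; _⊆_; ∣_∣) renaming (_∈_ to _∈ˢ_)
open import Data.Fin.Subset.Properties using (_∈?_; _⊆?_; ⊆-refl; drop-∷-⊆; p⊆q⇒∣p∣≤∣q∣)
open import Data.Integer using (+_)
import Data.Integer as ℤ
import Data.Integer.Properties as ℤ
open import Data.List using (List; []; _∷_; _++_; map; filter; length)
open import Data.List.Membership.Propositional using (_∈_; lose)
open import Data.List.Membership.Propositional.Properties using (∈-map⁺; ∈-++⁺ˡ; ∈-++⁺ʳ)
open import Data.List.Properties using (length-++; filter-++)
open import Data.List.Relation.Unary.All as All using (All; []; _∷_)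
open import Data.List.Relation.Unary.Any using (Any; here; any?; satisfied)
open import Data.Nat using (zero; _+_; _≡ᵇ_; z≤n; s≤s)
open import Data.Nat.Combinatorics using (nCk+nC[k+1]≡[n+1]C[k+1])
import Data.Nat.Coprimality as Coprime
open import Data.Nat.Properties as ℕ using (≡ᵇ⇒≡; ≡⇒≡ᵇ; suc-injective; +-comm; +-suc)
open import Algebra.Properties.CommutativeSemigroup ℕ.+-commutativeSemigroup using (interchange)
open import Data.Product using (_,_; proj₁; proj₂; ∃)
open import Data.Rational using (mkℚ)
import Data.Rational as ℚ
import Data.Rational.Properties as ℚ
open import Data.Rational.Solver using (module +-*-Solver)
open import Data.Vec using ([]; _∷_; _[_]=_; insertAt; removeAt; lookup)
open import Data.Vec.Properties
  using (insertAt-lookup; insertAt-punchIn; insertAt-removeAt; []=⇒lookup; lookup⇒[]=)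
open import Function using (_∘_)
open import Function.Bundles using (mk⇔; Equivalence)
open import Relation.Binary.PropositionalEquality
open import Relation.Nullary using (Dec; yes; no; does; contradiction; ¬?)
open import Relation.Nullary.Decidable using (T?; _×-dec_)

open Equivalence using (to; from)

private variable
  A B : Set
  k N : ℕ

count-++ : (p : A → Bool) (xs ys : List A) → count p (xs ++ ys) ≡ count p xs + count p ys
count-++ p xs ys = trans (cong length (filter-++ (T? ∘ p) xs ys)) (length-++ (filter (T? ∘ p) xs))

count-map : (p : B → Bool) (f : A → B) (xs : List A) → count p (map f xs) ≡ count (p ∘ f) xs
count-map p f [] = refl
count-map p f (x ∷ xs) with p (f x)
... | true  = cong suc (count-map p f xs)
... | false = count-map p f xs

count-cong : {p q : A → Bool} → (∀ a → p a ≡ q a) → (xs : List A) → count p xs ≡ count q xs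
count-cong p≗q [] = refl
count-cong {p = p} {q} p≗q (x ∷ xs) with p x | q x | p≗q x
... | true  | true  | refl = cong suc (count-cong p≗q xs)
... | false | false | refl = count-cong p≗q xs

count-none : {p : A → Bool} → (∀ a → p a ≡ false) → (xs : List A) → count p xs ≡ 0
count-none p≗false [] = refl
count-none {p = p} p≗false (x ∷ xs) rewrite p≗false x = count-none p≗false xs

count-mono : {p q : A → Bool} → (∀ a → T (p a) → T (q a)) → (xs : List A) → count p xs ≤ count q xs
count-mono p⇒q [] = z≤n
count-mono {p = p} {q} p⇒q (x ∷ xs) with p x | q x | p⇒q x
... | true  | true  | _ = s≤s (count-mono p⇒q xs)
... | false | true  | _ = ℕ.m≤n⇒m≤1+n (count-mono p⇒q xs)
... | false | false | _ = count-mono p⇒q xs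
... | true  | false | h = contradiction (h _) λ ()

count-partition : (p q m : A → Bool) → (∀ a → T (q a) → T (p a)) → (xs : List A) →
  count (λ a → p a ∧ m a) xs ≡ count (λ a → q a ∧ m a) xs + count (λ a → (p a ∧ not (q a)) ∧ m a) xs
count-partition p q m q⇒p [] = refl
count-partition p q m q⇒p (x ∷ xs) with p x | q x | m x | q⇒p x
... | true  | true  | true  | _ = cong suc (count-partition p q m q⇒p xs)
... | true  | false | true  | _ = trans (cong suc (count-partition p q m q⇒p xs)) (sym (+-suc _ _))
... | true  | true  | false | _ = count-partition p q m q⇒p xs
... | true  | false | false | _ = count-partition p q m q⇒p xs
... | false | false | _     | _ = count-partition p q m q⇒p xs
... | false | true  | _     | h = contradiction (h _) λ ()

T-does : {P : Set} (d : Dec P) → T (does d) ⇔ P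
T-does (yes p) = mk⇔ (λ _ → p) (λ _ → _)
T-does (no ¬p) = mk⇔ (λ ()) ¬p

T-not : {b : Bool} → T (not b) ⇔ (¬ T b)
T-not {b} = T-does (¬? (T? b))

T-⇒ : (a b c : Bool) → T (not (a ∧ b) ∨ c) ⇔ (T a → T b → T c)
T-⇒ true  true  true  = mk⇔ (λ _ _ _ → _) (λ _ → _)
T-⇒ true  true  false = mk⇔ (λ ()) (λ h → h _ _)
T-⇒ true  false _     = mk⇔ (λ _ _ ()) (λ _ → _)
T-⇒ false _     _     = mk⇔ (λ _ ()) (λ _ → _)

T-allB : (p : A → Bool) (xs : List A) → T (allB p xs) ⇔ All (T ∘ p) xs
T-allB p []       = mk⇔ (λ _ → []) (λ _ → _)
T-allB p (x ∷ xs) = mk⇔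
  (λ h → let (px , pxs) = to T-∧ h in px ∷ to (T-allB p xs) pxs)
  (λ { (px ∷ pxs) → from T-∧ (px , from (T-allB p xs) pxs) })

∈-allSubsets : (s : Subset N) → s ∈ allSubsets N
∈-allSubsets [] = here refl
∈-allSubsets {suc N} (outside ∷ s) = ∈-++⁺ˡ (∈-map⁺ (outside ∷_) (∈-allSubsets s))
∈-allSubsets {suc N} (inside ∷ s) =
  ∈-++⁺ʳ (map (outside ∷_) (allSubsets N)) (∈-map⁺ (inside ∷_) (∈-allSubsets s))

All-allSubsets⇔ : {P : Subset N → Set} → All P (allSubsets N) ⇔ (∀ s → P s)
All-allSubsets⇔ = mk⇔ (λ all s → All.lookup all (∈-allSubsets s)) (λ P-all → All.tabulate (λ {s} _ → P-all s))

count-allSubsets-suc : (p : Subset (suc N) → Bool) →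
  count p (allSubsets (suc N)) ≡
  count (λ s → p (outside ∷ s)) (allSubsets N) + count (λ s → p (inside ∷ s)) (allSubsets N)
count-allSubsets-suc {N} p = begin
  count p (map (outside ∷_) (allSubsets N) ++ map (inside ∷_) (allSubsets N))
    ≡⟨ count-++ p (map (outside ∷_) (allSubsets N)) _ ⟩
  count p (map (outside ∷_) (allSubsets N)) + count p (map (inside ∷_) (allSubsets N))
    ≡⟨ cong₂ _+_ (count-map p (outside ∷_) (allSubsets N)) (count-map p (inside ∷_) (allSubsets N)) ⟩
  count (λ s → p (outside ∷ s)) (allSubsets N) + count (λ s → p (inside ∷ s)) (allSubsets N) ∎
  where open ≡-Reasoning

count-allSubsets-insertAt : (p : Subset (suc N) → Bool) (v : Fin (suc N)) →
  count p (allSubsets (suc N)) ≡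
  count (λ s → p (insertAt s v outside)) (allSubsets N) + count (λ s → p (insertAt s v inside)) (allSubsets N)
count-allSubsets-insertAt p fzero = count-allSubsets-suc p
count-allSubsets-insertAt {suc N} p (fsuc v) = begin
  count p (allSubsets (suc (suc N)))
    ≡⟨ count-allSubsets-suc p ⟩
  count (λ s → p (outside ∷ s)) (allSubsets (suc N)) + count (λ s → p (inside ∷ s)) (allSubsets (suc N))
    ≡⟨ cong₂ _+_ (count-allSubsets-insertAt (λ s → p (outside ∷ s)) v)
                 (count-allSubsets-insertAt (λ s → p (inside ∷ s)) v) ⟩
  (part outside outside + part outside inside) + (part inside outside + part inside inside)
    ≡⟨ interchange (part outside outside) (part outside inside) (part inside outside) (part inside inside) ⟩
  (part outside outside + part inside outside) + (part outside inside + part inside inside)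
    ≡⟨ sym (cong₂ _+_ (count-allSubsets-suc (λ s → p (insertAt s (fsuc v) outside)))
                      (count-allSubsets-suc (λ s → p (insertAt s (fsuc v) inside)))) ⟩
  count (λ s → p (insertAt s (fsuc v) outside)) (allSubsets (suc N)) +
  count (λ s → p (insertAt s (fsuc v) inside)) (allSubsets (suc N)) ∎
  where
  open ≡-Reasoning
  part : Bool → Bool → ℕ
  part b c = count (λ s → p (b ∷ insertAt s v c)) (allSubsets N)

count-allSubsets-size : ∀ N k → count (λ s → ∣ s ∣ ≡ᵇ k) (allSubsets N) ≡ N C k
count-allSubsets-size zero    zero    = refl
count-allSubsets-size zero    (suc k) = refl
count-allSubsets-size (suc N) zero    = begin
  count (λ s → ∣ s ∣ ≡ᵇ 0) (allSubsets (suc N))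
    ≡⟨ count-allSubsets-suc {N} (λ s → ∣ s ∣ ≡ᵇ 0) ⟩
  count (λ s → ∣ s ∣ ≡ᵇ 0) (allSubsets N) + count (λ s → suc ∣ s ∣ ≡ᵇ 0) (allSubsets N)
    ≡⟨ cong₂ _+_ (count-allSubsets-size N zero) (count-none (λ _ → refl) (allSubsets N)) ⟩
  1 ∎
  where open ≡-Reasoning
count-allSubsets-size (suc N) (suc k) = begin
  count (λ s → ∣ s ∣ ≡ᵇ suc k) (allSubsets (suc N))
    ≡⟨ count-allSubsets-suc {N} (λ s → ∣ s ∣ ≡ᵇ suc k) ⟩
  count (λ s → ∣ s ∣ ≡ᵇ suc k) (allSubsets N) + count (λ s → ∣ s ∣ ≡ᵇ k) (allSubsets N)
    ≡⟨ cong₂ _+_ (count-allSubsets-size N (suc k)) (count-allSubsets-size N k) ⟩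
  N C suc k + N C k
    ≡⟨ +-comm (N C suc k) (N C k) ⟩
  N C k + N C suc k
    ≡⟨ nCk+nC[k+1]≡[n+1]C[k+1] N k ⟩
  suc N C suc k ∎
  where open ≡-Reasoning

∣insertAt∣ : (s : Subset N) (v : Fin (suc N)) (b : Bool) → ∣ insertAt s v b ∣ ≡ ∣ b ∷ s ∣
∣insertAt∣ s             fzero    b       = refl
∣insertAt∣ (outside ∷ s) (fsuc v) outside = ∣insertAt∣ s v outside
∣insertAt∣ (outside ∷ s) (fsuc v) inside  = ∣insertAt∣ s v inside
∣insertAt∣ (inside  ∷ s) (fsuc v) outside = cong suc (∣insertAt∣ s v outside)
∣insertAt∣ (inside  ∷ s) (fsuc v) inside  = cong suc (∣insertAt∣ s v inside)

does-∈? : (x : Fin N) (p : Subset N) → does (x ∈? p) ≡ lookup p x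
does-∈? fzero    (inside  ∷ p) = refl
does-∈? fzero    (outside ∷ p) = refl
does-∈? (fsuc x) (_ ∷ p)       = does-∈? x p

does-∈?-insertAt : (s : Subset N) (v : Fin (suc N)) (b : Bool) → does (v ∈? insertAt s v b) ≡ b
does-∈?-insertAt s v b = trans (does-∈? v (insertAt s v b)) (insertAt-lookup s v b)

does-∈?-insertAt-punchIn : (s : Subset N) (v : Fin (suc N)) (b : Bool) (x : Fin N) →
  does (punchIn v x ∈? insertAt s v b) ≡ does (x ∈? s)
does-∈?-insertAt-punchIn s v b x =
  trans (does-∈? (punchIn v x) (insertAt s v b)) (trans (insertAt-punchIn s v b x) (sym (does-∈? x s)))

∈-insertAt : (s : Subset N) (v : Fin (suc N)) → v ∈ˢ insertAt s v inside
∈-insertAt s v = lookup⇒[]= v (insertAt s v inside) (insertAt-lookup s v inside)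

∈-insertAt-punchIn⇔ : (s : Subset N) (v : Fin (suc N)) (b : Bool) (x : Fin N) →
  punchIn v x ∈ˢ insertAt s v b ⇔ x ∈ˢ s
∈-insertAt-punchIn⇔ s v b x = mk⇔
  (λ x∈ → lookup⇒[]= x s (trans (sym (insertAt-punchIn s v b x)) ([]=⇒lookup x∈)))
  (λ x∈ → lookup⇒[]= (punchIn v x) (insertAt s v b) (trans (insertAt-punchIn s v b x) ([]=⇒lookup x∈)))

insertAt-mono-⊆ : {e s : Subset N} (v : Fin (suc N)) (b : Bool) → e ⊆ s → insertAt e v b ⊆ insertAt s v inside
insertAt-mono-⊆ {e = e} {s} v b e⊆s {x} x∈ with v Fin.≟ x
... | yes refl = ∈-insertAt s v
... | no  v≢x  = subst (_∈ˢ insertAt s v inside) (punchIn-punchOut v≢x)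
  (from (∈-insertAt-punchIn⇔ s v inside _) (e⊆s (to (∈-insertAt-punchIn⇔ e v b _)
    (subst (_∈ˢ insertAt e v b) (sym (punchIn-punchOut v≢x)) x∈))))

insertAt-cancel-⊆ : {e s : Subset N} (v : Fin (suc N)) (b c : Bool) → insertAt e v b ⊆ insertAt s v c → e ⊆ s
insertAt-cancel-⊆ {e = e} {s} v b c sub {x} =
  to (∈-insertAt-punchIn⇔ s v c x) ∘ sub ∘ from (∈-insertAt-punchIn⇔ e v b x)

p⊆q∧∣p∣≡∣q∣⇒p≡q : {p q : Subset N} → p ⊆ q → ∣ p ∣ ≡ ∣ q ∣ → p ≡ q
p⊆q∧∣p∣≡∣q∣⇒p≡q {p = []}          {[]}          _   _ = refl
p⊆q∧∣p∣≡∣q∣⇒p≡q {p = outside ∷ p} {outside ∷ q} p⊆q eq =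
  cong (outside ∷_) (p⊆q∧∣p∣≡∣q∣⇒p≡q (drop-∷-⊆ p⊆q) eq)
p⊆q∧∣p∣≡∣q∣⇒p≡q {p = inside ∷ p}  {inside ∷ q}  p⊆q eq =
  cong (inside ∷_) (p⊆q∧∣p∣≡∣q∣⇒p≡q (drop-∷-⊆ p⊆q) (suc-injective eq))
p⊆q∧∣p∣≡∣q∣⇒p≡q {p = inside ∷ p}  {outside ∷ q} p⊆q _  = contradiction (p⊆q _[_]=_.here) λ ()
p⊆q∧∣p∣≡∣q∣⇒p≡q {p = outside ∷ p} {inside ∷ q}  p⊆q eq =
  contradiction eq (ℕ.<⇒≢ (s≤s (p⊆q⇒∣p∣≤∣q∣ (drop-∷-⊆ p⊆q))))

IsClique : Graph k N → Subset N → Set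
IsClique {k} G S = ∣ S ∣ ≡ suc k × (∀ e → e ⊆ S → ∣ e ∣ ≡ k → T (edge G e))

isCliqueB⇔IsClique : (G : Graph k N) (S : Subset N) → T (isCliqueB G S) ⇔ IsClique G S
isCliqueB⇔IsClique {k} {N} G S = mk⇔
  (λ h → let (∣S∣ , edges) = to T-∧ h in
    ≡ᵇ⇒≡ _ _ ∣S∣ , λ e → to (edge⇔ e) (to All-allSubsets⇔ (to (T-allB _ _) edges) e))
  (λ (∣S∣ , edges) → from T-∧
    (≡⇒≡ᵇ _ _ ∣S∣ , from (T-allB _ _) (from All-allSubsets⇔ λ e → from (edge⇔ e) (edges e))))
  where
  edge⇔ : (e : Subset N) →
    T (not (does (e ⊆? S) ∧ (∣ e ∣ ≡ᵇ k)) ∨ edge G e) ⇔ (e ⊆ S → ∣ e ∣ ≡ k → T (edge G e))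
  edge⇔ e = mk⇔
    (λ h (e⊆S : e ⊆ S) ∣e∣ → to (T-⇒ _ _ (edge G e)) h (from (T-does (e ⊆? S)) e⊆S) (≡⇒≡ᵇ _ _ ∣e∣))
    (λ h → from (T-⇒ _ _ (edge G e)) λ e⊆S ∣e∣ → h (to (T-does (e ⊆? S)) e⊆S) (≡ᵇ⇒≡ _ _ ∣e∣))

-- The vertices of the link are those of H other than v, numbered through punchIn v, so that
-- insertAt s v inside is s ∪ {v} and insertAt s v outside is s itself, seen as a subset of V(H).
link : Graph (suc k) (suc N) → Fin (suc N) → Graph k N
link H v = record
  { edge    = λ s → edge H (insertAt s v inside)
  ; uniform = λ s s∈H → suc-injective (trans (sym (∣insertAt∣ s v inside)) (uniform H _ s∈H))
  }

IsClique-insertAt⇔ : (H : Graph (suc k) (suc N)) (v : Fin (suc N)) (s : Subset N) →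
  IsClique H (insertAt s v inside) ⇔ (IsClique (link H v) s × T (edge H (insertAt s v outside)))
IsClique-insertAt⇔ {k} {N} H v s = mk⇔ restrict extend
  where
  restrict : IsClique H (insertAt s v inside) → IsClique (link H v) s × T (edge H (insertAt s v outside))
  restrict (∣s+v∣ , edges) =
    ( ( ∣s∣
      , λ e e⊆s ∣e∣ → edges (insertAt e v inside) (insertAt-mono-⊆ v inside e⊆s)
                            (trans (∣insertAt∣ e v inside) (cong suc ∣e∣)))
    , edges (insertAt s v outside) (insertAt-mono-⊆ v outside ⊆-refl)
            (trans (∣insertAt∣ s v outside) ∣s∣))
    where
    ∣s∣ : ∣ s ∣ ≡ suc k
    ∣s∣ = suc-injective (trans (sym (∣insertAt∣ s v inside)) ∣s+v∣)

  extend : IsClique (link H v) s × T (edge H (insertAt s v outside)) → IsClique H (insertAt s v inside)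
  extend ((∣s∣ , edges) , s∈H) =
    ( trans (∣insertAt∣ s v inside) (cong suc ∣s∣)
    , λ e → subst (λ e → e ⊆ insertAt s v inside → ∣ e ∣ ≡ suc k → T (edge H e))
                  (insertAt-removeAt e v) (edge-at (lookup e v) (removeAt e v)))
    where
    -- A (k+1)-subset of s ∪ {v} is either v plus a k-subset of s, or s itself.
    edge-at : (b : Bool) (e : Subset N) →
      insertAt e v b ⊆ insertAt s v inside → ∣ insertAt e v b ∣ ≡ suc k → T (edge H (insertAt e v b))
    edge-at inside  e e⊆ ∣e∣ =
      edges e (insertAt-cancel-⊆ v inside inside e⊆) (suc-injective (trans (sym (∣insertAt∣ e v inside)) ∣e∣))
    edge-at outside e e⊆ ∣e∣ rewrite p⊆q∧∣p∣≡∣q∣⇒p≡q (insertAt-cancel-⊆ v outside inside e⊆)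
                                       (trans (sym (∣insertAt∣ e v outside)) (trans ∣e∣ (sym ∣s∣)))
      = s∈H

countContaining : (Subset N → Bool) → Fin N → ℕ
countContaining {N} P x = count (λ S → P S ∧ does (x ∈? S)) (allSubsets N)

nonClique : Graph k N → Subset N → Bool
nonClique {k} G S = (∣ S ∣ ≡ᵇ suc k) ∧ not (isCliqueB G S)

countContaining-size : (x : Fin (suc N)) → countContaining (λ S → ∣ S ∣ ≡ᵇ suc k) x ≡ N C k
countContaining-size {N} {k} x = begin
  countContaining (λ S → ∣ S ∣ ≡ᵇ suc k) x
    ≡⟨ count-allSubsets-insertAt _ x ⟩
  count (λ s → (∣ insertAt s x outside ∣ ≡ᵇ suc k) ∧ does (x ∈? insertAt s x outside)) (allSubsets N) +
  count (λ s → (∣ insertAt s x inside ∣ ≡ᵇ suc k) ∧ does (x ∈? insertAt s x inside)) (allSubsets N)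
    ≡⟨ cong₂ _+_ (count-none without-x (allSubsets N)) (count-cong with-x (allSubsets N)) ⟩
  count (λ s → ∣ s ∣ ≡ᵇ k) (allSubsets N)
    ≡⟨ count-allSubsets-size N k ⟩
  N C k ∎
  where
  open ≡-Reasoning
  without-x : ∀ s → (∣ insertAt s x outside ∣ ≡ᵇ suc k) ∧ does (x ∈? insertAt s x outside) ≡ false
  without-x s rewrite does-∈?-insertAt s x outside = ∧-zeroʳ _
  with-x : ∀ s → (∣ insertAt s x inside ∣ ≡ᵇ suc k) ∧ does (x ∈? insertAt s x inside) ≡ (∣ s ∣ ≡ᵇ k)
  with-x s rewrite ∣insertAt∣ s x inside | does-∈?-insertAt s x inside = ∧-identityʳ _

tCount+countContaining-nonClique : (G : Graph k N) (x : Fin N) →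
  tCount G x + countContaining (nonClique G) x ≡ (N ∸ 1) C k
tCount+countContaining-nonClique {k} {suc N} G x = trans
  (sym (count-partition (λ S → ∣ S ∣ ≡ᵇ suc k) (isCliqueB G) (λ S → does (x ∈? S))
                        (λ _ → proj₁ ∘ to T-∧) (allSubsets (suc N))))
  (countContaining-size x)

deg≡numEdges-link : (H : Graph (suc k) (suc N)) (v : Fin (suc N)) → deg H v ≡ numEdges (link H v)
deg≡numEdges-link {N = N} H v = trans (count-allSubsets-insertAt _ v)
  (cong₂ _+_
    (count-none (λ s → trans (cong (edge H (insertAt s v outside) ∧_) (does-∈?-insertAt s v outside)) (∧-zeroʳ _))
                (allSubsets N))
    (count-cong (λ s → trans (cong (edge H (insertAt s v inside) ∧_) (does-∈?-insertAt s v inside)) (∧-identityʳ _))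
                (allSubsets N)))

deg-punchIn : (H : Graph (suc k) (suc N)) (v : Fin (suc N)) (x : Fin N) →
  deg H (punchIn v x) ≡ countContaining (λ s → edge H (insertAt s v outside)) x + deg (link H v) x
deg-punchIn {N = N} H v x = trans (count-allSubsets-insertAt _ v)
  (cong₂ _+_ (count-cong (λ s → cong (edge H (insertAt s v outside) ∧_) (does-∈?-insertAt-punchIn s v outside x))
                         (allSubsets N))
             (count-cong (λ s → cong (edge H (insertAt s v inside) ∧_) (does-∈?-insertAt-punchIn s v inside x))
                         (allSubsets N)))

InNoClique : Graph k N → Fin N → Set
InNoClique {N = N} H v = ¬ Σ (Subset N) (λ S → v ∈ˢ S × T (isCliqueB H S))

¬HasCovering⇒∃InNoClique : (H : Graph k N) → ¬ HasCovering H → ∃ (InNoClique H)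
¬HasCovering⇒∃InNoClique {N = N} H uncovered =
  let (v , ¬covered) = ¬∀⟶∃¬ N Covered covered? (λ all → uncovered (satisfied ∘ all))
  in v , λ (S , v∈S , clique) → ¬covered (lose (∈-allSubsets S) (v∈S , clique))
  where
  Covered : Fin N → Set
  Covered x = Any (λ S → x ∈ˢ S × T (isCliqueB H S)) (allSubsets N)
  covered? : (x : Fin N) → Dec (Covered x)
  covered? x = any? (λ S → (x ∈? S) ×-dec T? (isCliqueB H S)) (allSubsets N)

deg-punchIn≤ : (H : Graph (suc k) (suc N)) (v : Fin (suc N)) → InNoClique H v → (x : Fin N) →
  deg H (punchIn v x) ≤ deg (link H v) x + countContaining (nonClique (link H v)) x
deg-punchIn≤ {N = N} H v uncovered x = begin
  deg H (punchIn v x)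
    ≡⟨ deg-punchIn H v x ⟩
  countContaining (λ s → edge H (insertAt s v outside)) x + deg (link H v) x
    ≡⟨ +-comm _ (deg (link H v) x) ⟩
  deg (link H v) x + countContaining (λ s → edge H (insertAt s v outside)) x
    ≤⟨ ℕ.+-monoʳ-≤ (deg (link H v) x) (count-mono avoiding-v⇒nonClique (allSubsets N)) ⟩
  deg (link H v) x + countContaining (nonClique (link H v)) x ∎
  where
  open ℕ.≤-Reasoning
  nonClique-link : ∀ s → T (edge H (insertAt s v outside)) → T (nonClique (link H v) s)
  nonClique-link s s∈H = from T-∧
    ( ≡⇒≡ᵇ _ _ (trans (sym (∣insertAt∣ s v outside)) (uniform H _ s∈H))
    , from T-not λ clique → uncovered
        ( insertAt s v inside , ∈-insertAt s v
        , from (isCliqueB⇔IsClique H _)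
               (from (IsClique-insertAt⇔ H v s) (to (isCliqueB⇔IsClique (link H v) s) clique , s∈H))))
  avoiding-v⇒nonClique : ∀ s → T (edge H (insertAt s v outside) ∧ does (x ∈? s)) →
                                T (nonClique (link H v) s ∧ does (x ∈? s))
  avoiding-v⇒nonClique s h = let (s∈H , x∈s) = to T-∧ h in from T-∧ (nonClique-link s s∈H , x∈s)

cone : Graph k N → Graph (suc k) (suc N)
cone {k} {N} G = record { edge = edges ; uniform = uniform-edges }
  where
  edges : Subset (suc N) → Bool
  edges (inside  ∷ s) = edge G s
  edges (outside ∷ s) = nonClique G s
  uniform-edges : (e : Subset (suc N)) → T (edges e) → ∣ e ∣ ≡ suc k
  uniform-edges (inside  ∷ s) s∈G      = cong suc (uniform G s s∈G)
  uniform-edges (outside ∷ s) nonclique = ≡ᵇ⇒≡ _ _ (proj₁ (to T-∧ nonclique))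

InNoClique-cone : (G : Graph k N) → InNoClique (cone G) fzero
InNoClique-cone G ((inside ∷ s) , _ , clique) =
  let (clique-G , nonclique) = to (IsClique-insertAt⇔ (cone G) fzero s) (to (isCliqueB⇔IsClique (cone G) _) clique)
  in to T-not (proj₂ (to T-∧ nonclique)) (from (isCliqueB⇔IsClique G s) clique-G)

deg-cone-fsuc : (G : Graph k N) (x : Fin N) → deg (cone G) (fsuc x) ≡ deg G x + countContaining (nonClique G) x
deg-cone-fsuc G x = trans (deg-punchIn (cone G) fzero x) (+-comm _ (deg G x))

ℕtoℚ≡mkℚ : ∀ n → ℕtoℚ n ≡ mkℚ (+ n) 0 (Coprime.sym (Coprime.1-coprimeTo n))
ℕtoℚ≡mkℚ n = ℚ.normalize-coprime (Coprime.sym (Coprime.1-coprimeTo n))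

ℕtoℚ-+ : ∀ m n → ℕtoℚ (m + n) ≡ ℕtoℚ m ℚ.+ ℕtoℚ n
ℕtoℚ-+ m n rewrite ℕtoℚ≡mkℚ m | ℕtoℚ≡mkℚ n | ℤ.*-identityʳ (+ m) | ℤ.*-identityʳ (+ n) = refl

ℕtoℚ-mono-≤ : {m n : ℕ} → m ≤ n → ℕtoℚ m ≤ℚ ℕtoℚ n
ℕtoℚ-mono-≤ {m} {n} m≤n rewrite ℕtoℚ≡mkℚ m | ℕtoℚ≡mkℚ n =
  ℚ.*≤* (subst₂ ℤ._≤_ (sym (ℤ.*-identityʳ (+ m))) (sym (ℤ.*-identityʳ (+ n))) (ℤ.+≤+ m≤n))

p≤q⇒r-q≤r-p : {p q : ℚ} (r : ℚ) → p ≤ℚ q → r - q ≤ℚ r - p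
p≤q⇒r-q≤r-p r p≤q = ℚ.+-monoʳ-≤ r (ℚ.neg-antimono-≤ p≤q)

αc≤d+e⇔t-d≤[1-α]c : (α : ℚ) (t e d c : ℕ) → t + e ≡ c →
  α * ℕtoℚ c ≤ℚ ℕtoℚ (d + e) ⇔ ℕtoℚ t - ℕtoℚ d ≤ℚ (1ℚ - α) * ℕtoℚ c
αc≤d+e⇔t-d≤[1-α]c α t e d _ refl rewrite ℕtoℚ-+ t e | ℕtoℚ-+ d e = mk⇔
  (λ αc≤d+e → subst₂ _≤ℚ_ ([t+e]-[d+e]≡t-d [t] [e] [d]) (c-αc≡[1-α]c α ([t] ℚ.+ [e]))
                          (p≤q⇒r-q≤r-p ([t] ℚ.+ [e]) αc≤d+e))
  (λ t-d≤[1-α]c → subst₂ _≤ℚ_ (c-[1-α]c≡αc α ([t] ℚ.+ [e])) ([t+e]-[t-d]≡d+e [t] [e] [d])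
                              (p≤q⇒r-q≤r-p ([t] ℚ.+ [e]) t-d≤[1-α]c))
  where
  [t] [e] [d] : ℚ
  [t] = ℕtoℚ t
  [e] = ℕtoℚ e
  [d] = ℕtoℚ d
  open +-*-Solver
  [t+e]-[d+e]≡t-d : ∀ t e d → (t ℚ.+ e) - (d ℚ.+ e) ≡ t - d
  [t+e]-[d+e]≡t-d = solve 3 (λ t e d → (t :+ e) :- (d :+ e) := t :- d) refl
  [t+e]-[t-d]≡d+e : ∀ t e d → (t ℚ.+ e) - (t - d) ≡ d ℚ.+ e
  [t+e]-[t-d]≡d+e = solve 3 (λ t e d → (t :+ e) :- (t :- d) := d :+ e) refl
  c-αc≡[1-α]c : ∀ α c → c - α * c ≡ (1ℚ - α) * c
  c-αc≡[1-α]c = solve 2 (λ α c → c :- α :* c := (con 1ℚ :- α) :* c) refl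
  c-[1-α]c≡αc : ∀ α c → c - (1ℚ - α) * c ≡ α * c
  c-[1-α]c≡αc = solve 2 (λ α c → c :- (con 1ℚ :- α) :* c := α :* c) refl

proposition2p3 : (r n : ℕ) → 2 ≤ r → (α : ℚ) →
    (Σ (Graph r (suc n)) (λ H →
        ((x : Fin (suc n)) → α * ℕtoℚ ((n ∸ 1) C (r ∸ 1)) ≤ℚ ℕtoℚ (deg H x))
        × ¬ HasCovering H))
    ⇔
    (Σ (Graph (r ∸ 1) n) (λ G →
        (α * ℕtoℚ ((n ∸ 1) C (r ∸ 1)) ≤ℚ ℕtoℚ (numEdges G))
        × ((x : Fin n) →
            ℕtoℚ (tCount G x) - ℕtoℚ (deg G x) ≤ℚ (1ℚ - α) * ℕtoℚ ((n ∸ 1) C (r ∸ 1)))))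
proposition2p3 (suc (suc k)) n (s≤s (s≤s z≤n)) α = mk⇔
  (λ (H , δ≥ , uncovered) →
    let (v , v-uncovered) = ¬HasCovering⇒∃InNoClique H uncovered
        G = link H v
    in G
     , subst (λ d → α * c ≤ℚ ℕtoℚ d) (deg≡numEdges-link H v) (δ≥ v)
     , λ x → to (codegree⇔ G x) (ℚ.≤-trans (δ≥ (punchIn v x)) (ℕtoℚ-mono-≤ (deg-punchIn≤ H v v-uncovered x))))
  (λ (G , e≥ , codegree≤) →
      cone G
    , (λ { fzero    → subst (λ d → α * c ≤ℚ ℕtoℚ d) (sym (deg≡numEdges-link (cone G) fzero)) e≥
         ; (fsuc x) → subst (λ d → α * c ≤ℚ ℕtoℚ d) (sym (deg-cone-fsuc G x)) (from (codegree⇔ G x) (codegree≤ x)) })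
    , λ covered → InNoClique-cone G (covered fzero))
  where
  c : ℚ
  c = ℕtoℚ ((n ∸ 1) C suc k)
  codegree⇔ : (G : Graph (suc k) n) (x : Fin n) →
    α * c ≤ℚ ℕtoℚ (deg G x + countContaining (nonClique G) x) ⇔
    ℕtoℚ (tCount G x) - ℕtoℚ (deg G x) ≤ℚ (1ℚ - α) * c
  codegree⇔ G x = αc≤d+e⇔t-d≤[1-α]c α (tCount G x) (countContaining (nonClique G) x) (deg G x) _
    (tCount+countContaining-nonClique G x)
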